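{- Let $T$ be a pre-Galois word, $p_o=\mathrm{Per}_o(T)$ and $p_e=\mathrm{Per}_e(T)$. Let $z$ be a symbol and $T'=T\cdot z$, and consider the conditions (a) $T'[1..|T|-p_o+1]\succ_{\mathrm{alt}}T'[p_o+1..|T|+1]$ and (b) $T'[1..|T|-p_e+1]\succ_{\mathrm{alt}}T'[p_e+1..|T|+1]$. Suppose at least one of (a), (b) holds. Then for every word $S$, $\mathrm{SPref}(T'S)=T'[1..p]$, where $p=\min\{p_o,p_e\}$ if both (a) and (b) hold; $p=p_o$ if (a) holds and $T'[1..|T|-p_e+1]\preceq_{\mathrm{alt}}T'[p_e+1..|T|+1]$; and $p=p_e$ otherwise (i.e., if (b) holds but (a) does not).
   Context: $W[i..j]$ is the factor from position $i$ to $j$ (1-indexed), and is $\varepsilon$ if $i>j$. An integer $p\in[1..|W|]$ is a period of $W$ if $W[i+p]=W[i]$ for all $i\in[1..|W|-p]$. $\mathrm{Per}_o(W)$ (resp. $\mathrm{Per}_e(W)$) is the shortest odd (resp. even) period of $W$, set to $|W|+1$ if none exists. Alternating order: for words $S,T$ with $S^\omega\neq T^\omega$ ($X^\omega$ the infinite repetition of $X$), let $j$ be the first position with $S^\omega[j]\neq T^\omega[j]$; $S\prec_{\mathrm{alt}}T$ if $j$ is odd and $S^\omega[j]<T^\omega[j]$, or $j$ is even and $S^\omega[j]>T^\omega[j]$. $S=_{\mathrm{alt}}T$ if $S^\omega=T^\omega$; $\varepsilon\succ_{\mathrm{alt}}X$ for every nonempty $X$; $\preceq_{\mathrm{alt}}$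 means $\prec_{\mathrm{alt}}$ or $=_{\mathrm{alt}}$, and $\succeq_{\mathrm{alt}}$ is its reverse. A word $T$ is pre-Galois if every proper suffix $S$ of $T$ is a prefix of $T$ or satisfies $S\succ_{\mathrm{alt}}T$. For a nonempty word $W$, $\mathrm{SPref}(W)$ is the shortest nonempty prefix $P$ of $W$ such that $P\succeq_{\mathrm{alt}}W$ if $|P|$ is even and $P\preceq_{\mathrm{alt}}W$ if $|P|$ is odd. -}

module Defs where

open import Data.Nat using (ℕ; zero; suc; _+_; _∸_; _≤_; _<_; _%_)
open import Data.List using (List; []; _∷_; _++_; length; take; drop)
open import Data.Maybe using (Maybe; just; nothing)
open import Data.Product using (Σ; ∃; _×_; _,_)
open import Data.Sum using (_⊎_)
open import Data.Unit using (⊤)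
open import Data.Empty using (⊥)
open import Relation.Nullary using (¬_)
open import Relation.Binary.PropositionalEquality using (_≡_)

Odd : ℕ → Set
Odd n = n % 2 ≡ 1

Even : ℕ → Set
Even n = n % 2 ≡ 0

-- Words over an alphabet A with a strict order _<ₐ_ on symbols
-- (the statement assumes _<ₐ_ is a strict total order w.r.t. ≡).
module Alphabet (A : Set) (_<ₐ_ : A → A → Set) where

  at : List A → ℕ → Maybe A
  at []       _       = nothing
  at (x ∷ xs) zero    = just x
  at (x ∷ xs) (suc n) = at xs n

  nth : A → List A → ℕ → A
  nth d []       _       = d
  nth d (x ∷ xs) zero    = x
  nth d (x ∷ xs) (suc n) = nth d xs n

  -- (x ∷ xs)^ω at 0-indexed position i
  ω : A → List A → ℕ → A
  ω x xs i = nth x (x ∷ xs) (i % suc (length xs))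

  -- factor W[i..j], 1-indexed, empty if i > j
  fac : List A → ℕ → ℕ → List A
  fac W i j = take (suc j ∸ i) (drop (i ∸ 1) W)

  Period : List A → ℕ → Set
  Period W p = (1 ≤ p) × (p ≤ length W) ×
               (∀ i → i + p < length W → at W (i + p) ≡ at W i)

  IsPerO : List A → ℕ → Set
  IsPerO W p =
      (Period W p × Odd p × (∀ q → Period W q → Odd q → p ≤ q))
    ⊎ ((∀ q → Period W q → ¬ Odd q) × p ≡ suc (length W))

  IsPerE : List A → ℕ → Set
  IsPerE W p =
      (Period W p × Even p × (∀ q → Period W q → Even q → p ≤ q))
    ⊎ ((∀ q → Period W q → ¬ Even q) × p ≡ suc (length W))

  -- first difference of S^ω and T^ω at 0-indexed position j,
  -- i.e. 1-indexed position j+1; S ≺alt T there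
  AltLessAt : ℕ → A → A → Set
  AltLessAt j a b = (Even j × a <ₐ b) ⊎ (Odd j × b <ₐ a)

  _≺alt_ : List A → List A → Set
  []       ≺alt _        = ⊥
  (s ∷ ss) ≺alt []       = ⊤
  (s ∷ ss) ≺alt (t ∷ ts) =
    ∃ λ j → (∀ i → i < j → ω s ss i ≡ ω t ts i)
          × AltLessAt j (ω s ss j) (ω t ts j)

  _=alt_ : List A → List A → Set
  []       =alt []       = ⊤
  []       =alt (_ ∷ _)  = ⊥
  (_ ∷ _)  =alt []       = ⊥
  (s ∷ ss) =alt (t ∷ ts) = ∀ i → ω s ss i ≡ ω t ts i

  _≻alt_ : List A → List A → Set
  S ≻alt T = T ≺alt S

  _⪯alt_ : List A → List A → Set
  S ⪯alt T = (S ≺alt T) ⊎ (S =alt T)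

  _⪰alt_ : List A → List A → Set
  S ⪰alt T = T ⪯alt S

  IsPrefix : List A → List A → Set
  IsPrefix P W = ∃ λ R → P ++ R ≡ W

  PreGalois : List A → Set
  PreGalois T = ∀ k → 1 ≤ k → k ≤ length T →
    IsPrefix (drop k T) T ⊎ (drop k T ≻alt T)

  SCond : List A → List A → Set
  SCond P W = (Even (length P) → P ⪰alt W) × (Odd (length P) → P ⪯alt W)

  IsSPref : List A → List A → Set
  IsSPref W P = IsPrefix P W × ¬ (P ≡ []) × SCond P W ×
    (∀ Q → IsPrefix Q W → ¬ (Q ≡ []) → length Q < length P → ¬ SCond Q W)

{-# OPTIONS --safe #-}
module Submission where

-- Let n = |T|, W = T′S, and let p be a period of T with r = n − p. The two factors compared in
-- (a)/(b) then differ only in their last letters, z and T[r+1], so the condition says that z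
-- precedes T[r+1] in the alternating order of position r+1 (`ZPrecedes p`). The power of T′[1..p]
-- agrees with W in the first n letters and then shows T[r+1] where W has z; that comparison is
-- exactly the SPref condition for T′[1..p]. A shorter nonempty prefix Q of W fails the condition:
-- if |Q| is not a period of T, the pre-Galois property decides the comparison at the first break
-- of |Q|-periodicity; if it is, |Q| has the parity opposite to p (p is shortest among periods of
-- its parity), and the pre-Galois property applied to the odd shift p − |Q| reverses the
-- comparison at z (`ZPrecedes⇒ZFollows`). The same reversal shows that (a) and (b) never hold
-- together, so the first case of the statement is vacuous.

open import Defs
open import Algebra.Properties.CommutativeSemigroup using (x∙yz≈xz∙y)
open import Data.Empty using (⊥; ⊥-elim)
open import Data.List using (List; []; _∷_; _++_; length; take; drop)
open import Data.List.Properties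
  using (length-++; length-take; length-drop; take-all; drop-all; take++drop≡id; ++-assoc)
open import Data.Maybe using (just)
open import Data.Maybe.Properties using (just-injective)
open import Data.Nat
  using (ℕ; zero; suc; _+_; _∸_; _*_; _/_; _%_; _⊓_; _≤_; _<_; _≤?_; z≤n; s≤s; z<s; NonZero; parity)
open import Data.Nat.DivMod using (m%n<n; m<n⇒m%n≡m; [m+n]%n≡m%n; m≡m%n+[m/n]*n)
open import Data.Nat.Properties
  using (+-comm; +-assoc; +-identityʳ; +-suc; suc-injective; +-commutativeSemigroup;
         ≤-refl; ≤-trans; ≤-reflexive; <⇒≤; <⇒≱; <⇒≢; ≰⇒>; <-irrefl; <-trans; <-≤-trans; ≤-<-trans; <-cmp;
         m<1+n⇒m<n∨m≡n; m≤n⇒m≤1+n; m≤m+n; m≤n+m; m<m+n; m∸n≤m; m∸n+n≡m; m<n⇒0<n∸m; m≤n⇒m⊓n≡m;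
         +-∸-assoc; ∸-monoˡ-≤; ∸-monoʳ-<; +-monoˡ-<; +-monoˡ-≤; +-cancelʳ-<; m+n≤o⇒m≤o∸n; m≤o∸n⇒m+n≤o)
open import Data.Parity.Base using (Parity; 0ℙ; 1ℙ; _⁻¹) renaming (_+_ to _+ℙ_)
open import Data.Parity.Properties using (+-homo-+)
open import Data.Product using (_×_; ∃; _,_)
open import Data.Sum using (_⊎_; inj₁; inj₂; [_,_])
open import Function using (_∘_)
open import Relation.Nullary using (¬_; yes; no)
open import Relation.Unary using (Decidable)
open import Relation.Binary.Definitions using (tri<; tri≈; tri>)
open import Relation.Binary.PropositionalEquality
  using (_≡_; _≢_; refl; sym; trans; cong; cong₂; subst; subst₂; module ≡-Reasoning)
open import Relation.Binary.Structures using (IsStrictTotalOrder)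

allBelow-or-leastCounterexample : ∀ {P : ℕ → Set} → Decidable P → ∀ b →
  (∀ i → i < b → P i) ⊎ ∃ λ i → i < b × (∀ j → j < i → P j) × ¬ P i
allBelow-or-leastCounterexample P? zero = inj₁ λ _ ()
allBelow-or-leastCounterexample P? (suc b) with allBelow-or-leastCounterexample P? b
... | inj₂ (i , i<b , below , ¬Pi) = inj₂ (i , m≤n⇒m≤1+n i<b , below , ¬Pi)
... | inj₁ below with P? b
...   | no ¬Pb = inj₂ (b , ≤-refl , below , ¬Pb)
...   | yes Pb = inj₁ λ i i<1+b → [ below i , (λ { refl → Pb }) ] (m<1+n⇒m<n∨m≡n i<1+b)

Even⇒parity≡0ℙ : ∀ n → Even n → parity n ≡ 0ℙ
Even⇒parity≡0ℙ zero          _ = refl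
Even⇒parity≡0ℙ (suc zero)    ()
Even⇒parity≡0ℙ (suc (suc n)) e = Even⇒parity≡0ℙ n e

Odd⇒parity≡1ℙ : ∀ n → Odd n → parity n ≡ 1ℙ
Odd⇒parity≡1ℙ zero          ()
Odd⇒parity≡1ℙ (suc zero)    _ = refl
Odd⇒parity≡1ℙ (suc (suc n)) o = Odd⇒parity≡1ℙ n o

parity≡0ℙ⇒Even : ∀ n → parity n ≡ 0ℙ → Even n
parity≡0ℙ⇒Even zero          _ = refl
parity≡0ℙ⇒Even (suc zero)    ()
parity≡0ℙ⇒Even (suc (suc n)) e = parity≡0ℙ⇒Even n e

parity≡1ℙ⇒Odd : ∀ n → parity n ≡ 1ℙ → Odd n
parity≡1ℙ⇒Odd zero          ()
parity≡1ℙ⇒Odd (suc zero)    _ = refl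
parity≡1ℙ⇒Odd (suc (suc n)) o = parity≡1ℙ⇒Odd n o

parity≢⇒odd-∸ : ∀ {p q} → q ≤ p → parity q ≢ parity p → parity (p ∸ q) ≡ 1ℙ
parity≢⇒odd-∸ {p} {q} q≤p q≢p with parity (p ∸ q) in d
... | 1ℙ = refl
... | 0ℙ = ⊥-elim (q≢p (begin
  parity q                    ≡⟨ cong (_+ℙ parity q) d ⟨
  parity (p ∸ q) +ℙ parity q  ≡⟨ +-homo-+ (p ∸ q) q ⟨
  parity (p ∸ q + q)          ≡⟨ cong parity (m∸n+n≡m q≤p) ⟩
  parity p                    ∎))
  where open ≡-Reasoning

module AlternatingOrder {A : Set} (_⊏_ : A → A → Set) (⊏-sto : IsStrictTotalOrder _≡_ _⊏_) where
  open Alphabet A _⊏_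
  open IsStrictTotalOrder ⊏-sto using (irrefl; asym; _≟_) renaming (trans to ⊏-trans)
  open ≡-Reasoning

  Alt : Parity → A → A → Set
  Alt 0ℙ a b = a ⊏ b
  Alt 1ℙ a b = b ⊏ a

  Alt-irrefl : ∀ π {a} → ¬ Alt π a a
  Alt-irrefl 0ℙ = irrefl refl
  Alt-irrefl 1ℙ = irrefl refl

  Alt⇒≢ : ∀ π {a b} → Alt π a b → a ≢ b
  Alt⇒≢ π l refl = Alt-irrefl π l

  Alt-asym : ∀ π {a b} → Alt π a b → ¬ Alt π b a
  Alt-asym 0ℙ = asym
  Alt-asym 1ℙ = asym

  Alt-trans : ∀ π {a b c} → Alt π a b → Alt π b c → Alt π a c
  Alt-trans 0ℙ l m = ⊏-trans l m
  Alt-trans 1ℙ l m = ⊏-trans m l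

  Alt-⁻¹ : ∀ π {a b} → Alt π b a → Alt (π ⁻¹) a b
  Alt-⁻¹ 0ℙ l = l
  Alt-⁻¹ 1ℙ l = l

  Alt-+-even : ∀ j k {a b} → parity k ≡ 0ℙ → Alt (parity j) a b → Alt (parity (j + k)) a b
  Alt-+-even j k e l rewrite +-comm j k | +-homo-+ k j | e = l

  Alt-+-odd : ∀ j k {a b} → parity k ≡ 1ℙ → Alt (parity j) b a → Alt (parity (j + k)) a b
  Alt-+-odd j k o l rewrite +-comm j k | +-homo-+ k j | o = Alt-⁻¹ (parity j) l

  AltLessAt⇒Alt : ∀ j {a b} → AltLessAt j a b → Alt (parity j) a b
  AltLessAt⇒Alt zero          (inj₁ (_ , l)) = l
  AltLessAt⇒Alt zero          (inj₂ (() , _))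
  AltLessAt⇒Alt (suc zero)    (inj₁ (() , _))
  AltLessAt⇒Alt (suc zero)    (inj₂ (_ , l)) = l
  AltLessAt⇒Alt (suc (suc j)) l = AltLessAt⇒Alt j l

  Alt⇒AltLessAt : ∀ j {a b} → Alt (parity j) a b → AltLessAt j a b
  Alt⇒AltLessAt zero          l = inj₁ (refl , l)
  Alt⇒AltLessAt (suc zero)    l = inj₂ (refl , l)
  Alt⇒AltLessAt (suc (suc j)) l = Alt⇒AltLessAt j l

  AgreeBelow : ℕ → (ℕ → A) → (ℕ → A) → Set
  AgreeBelow m f g = ∀ i → i < m → f i ≡ g i

  -- For nonempty words, `≺alt` and `⪯alt` unfold definitionally to `≺ω` and `⪯ω` of the powers `ω x xs`.
  _≺ω_ : (ℕ → A) → (ℕ → A) → Set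
  f ≺ω g = ∃ λ j → AgreeBelow j f g × AltLessAt j (f j) (g j)

  _⪯ω_ : (ℕ → A) → (ℕ → A) → Set
  f ⪯ω g = f ≺ω g ⊎ (∀ i → f i ≡ g i)

  ≺ω-irrefl : ∀ {f} → ¬ f ≺ω f
  ≺ω-irrefl (j , _ , l) = Alt-irrefl (parity j) (AltLessAt⇒Alt j l)

  ≺ω-intro : ∀ {f g} m → AgreeBelow m f g → Alt (parity m) (f m) (g m) → f ≺ω g
  ≺ω-intro m agree l = m , agree , Alt⇒AltLessAt m l

  ≺ω-at-firstDifference : ∀ {f g} m → AgreeBelow m f g → f m ≢ g m → f ≺ω g →
                          Alt (parity m) (f m) (g m)
  ≺ω-at-firstDifference m agree differ (j , agreeʲ , l) with <-cmp j m
  ... | tri< j<m _ _  = ⊥-elim (Alt⇒≢ (parity j) (AltLessAt⇒Alt j l) (agree j j<m))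
  ... | tri≈ _ refl _ = AltLessAt⇒Alt m l
  ... | tri> _ _ m<j  = ⊥-elim (differ (agreeʲ m m<j))

  ⪯ω-refute : ∀ {f g} m → AgreeBelow m f g → Alt (parity m) (f m) (g m) → ¬ g ⪯ω f
  ⪯ω-refute m agree l (inj₁ g≺f) =
    Alt-asym (parity m) l
      (≺ω-at-firstDifference m (λ i i<m → sym (agree i i<m)) (Alt⇒≢ (parity m) l ∘ sym) g≺f)
  ⪯ω-refute m agree l (inj₂ g≡f) = Alt⇒≢ (parity m) l (sym (g≡f m))

  nth-default : ∀ d e X i → i < length X → nth d X i ≡ nth e X i
  nth-default d e (x ∷ X) zero    _         = refl
  nth-default d e (x ∷ X) (suc i) (s≤s i<X) = nth-default d e X i i<X

  nth-++ˡ : ∀ d X Y i → i < length X → nth d (X ++ Y) i ≡ nth d X i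
  nth-++ˡ d (x ∷ X) Y zero    _         = refl
  nth-++ˡ d (x ∷ X) Y (suc i) (s≤s i<X) = nth-++ˡ d X Y i i<X

  nth-++-length : ∀ d X y Y → nth d (X ++ y ∷ Y) (length X) ≡ y
  nth-++-length d []      y Y = refl
  nth-++-length d (x ∷ X) y Y = nth-++-length d X y Y

  nth-prefix : ∀ d {P X} i → IsPrefix P X → i < length P → nth d P i ≡ nth d X i
  nth-prefix d {P} i (R , refl) i<P = sym (nth-++ˡ d P R i i<P)

  nth-drop : ∀ d k X i → nth d (drop k X) i ≡ nth d X (i + k)
  nth-drop d zero    X       i = cong (nth d X) (sym (+-identityʳ i))
  nth-drop d (suc k) []      i = refl
  nth-drop d (suc k) (x ∷ X) i rewrite +-suc i k = nth-drop d k X i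

  nth-take : ∀ d k X i → i < k → nth d (take k X) i ≡ nth d X i
  nth-take d (suc k) []      i       _         = refl
  nth-take d (suc k) (x ∷ X) zero    _         = refl
  nth-take d (suc k) (x ∷ X) (suc i) (s≤s i<k) = nth-take d k X i i<k

  nth-extensional : ∀ d X Y → length X ≡ length Y → AgreeBelow (length X) (nth d X) (nth d Y) → X ≡ Y
  nth-extensional d []      []      _       _     = refl
  nth-extensional d (x ∷ X) (y ∷ Y) |X|≡|Y| agree =
    cong₂ _∷_ (agree 0 z<s)
              (nth-extensional d X Y (suc-injective |X|≡|Y|) (λ i i<X → agree (suc i) (s≤s i<X)))

  at≡just-nth : ∀ d X i → i < length X → at X i ≡ just (nth d X i)
  at≡just-nth d (x ∷ X) zero    _         = refl
  at≡just-nth d (x ∷ X) (suc i) (s≤s i<X) = at≡just-nth d X i i<X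

  take-isPrefix : ∀ k X → IsPrefix (take k X) X
  take-isPrefix k X = drop k X , take++drop≡id k X

  IsPrefix-++ : ∀ {P X} Y → IsPrefix P X → IsPrefix P (X ++ Y)
  IsPrefix-++ {P} Y (R , refl) = R ++ Y , sym (++-assoc P R Y)

  fac-suffix : ∀ X p m → length X ≤ m → fac X (p + 1) m ≡ drop p X
  fac-suffix X p m |X|≤m rewrite +-comm p 1 =
    take-all (m ∸ p) (drop p X) (subst (_≤ m ∸ p) (sym (length-drop p X)) (∸-monoˡ-≤ p |X|≤m))

  ω-lookup : ∀ d x xs i → i < suc (length xs) → ω x xs i ≡ nth d (x ∷ xs) i
  ω-lookup d x xs i i<q rewrite m<n⇒m%n≡m i<q = nth-default x d (x ∷ xs) i i<q

  ω-+length : ∀ x xs i → ω x xs (i + suc (length xs)) ≡ ω x xs i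
  ω-+length x xs i = cong (nth x (x ∷ xs)) ([m+n]%n≡m%n i (suc (length xs)))

  PeriodicBelow : ℕ → (ℕ → A) → ℕ → Set
  PeriodicBelow m f q = ∀ i → i + q < m → f (i + q) ≡ f i

  PeriodicBelow-cong : ∀ {m f g q} → AgreeBelow m f g → PeriodicBelow m f q → PeriodicBelow m g q
  PeriodicBelow-cong {q = q} agree per i i+q<m =
    trans (sym (agree (i + q) i+q<m)) (trans (per i i+q<m) (agree i (≤-<-trans (m≤m+n i q) i+q<m)))

  PeriodicBelow-+* : ∀ {m f q} → PeriodicBelow m f q → ∀ k i → i + k * q < m → f (i + k * q) ≡ f i
  PeriodicBelow-+* {f = f} per zero    i _ = cong f (+-identityʳ i)
  PeriodicBelow-+* {m} {f} {q} per (suc k) i i+kq<m = begin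
    f (i + (q + k * q))  ≡⟨ cong f i+[q+kq]≡i+kq+q ⟩
    f (i + k * q + q)    ≡⟨ per (i + k * q) i+kq+q<m ⟩
    f (i + k * q)        ≡⟨ PeriodicBelow-+* per k i (≤-<-trans (m≤m+n (i + k * q) q) i+kq+q<m) ⟩
    f i                  ∎
    where
    i+[q+kq]≡i+kq+q = x∙yz≈xz∙y +-commutativeSemigroup i q (k * q)
    i+kq+q<m = subst (_< m) i+[q+kq]≡i+kq+q i+kq<m

  PeriodicBelow-% : ∀ {m f q} .{{_ : NonZero q}} → PeriodicBelow m f q → ∀ i → i < m → f (i % q) ≡ f i
  PeriodicBelow-% {m} {f} {q} per i i<m = begin
    f (i % q)                ≡⟨ PeriodicBelow-+* per (i / q) (i % q) (subst (_< m) (m≡m%n+[m/n]*n i q) i<m) ⟨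
    f (i % q + (i / q) * q)  ≡⟨ cong f (m≡m%n+[m/n]*n i q) ⟨
    f i                      ∎

  PeriodicBelow-∸ : ∀ {m f p q} → PeriodicBelow m f q → PeriodicBelow m f p → q ≤ p → p ≤ m →
                    PeriodicBelow (m ∸ q) f (p ∸ q)
  PeriodicBelow-∸ {m} {f} {p} {q} perq perp q≤p p≤m i i+d<m∸q = begin
    f (i + d)      ≡⟨ perq (i + d) i+d+q<m ⟨
    f (i + d + q)  ≡⟨ cong f i+d+q≡i+p ⟩
    f (i + p)      ≡⟨ perp i (subst (_< m) i+d+q≡i+p i+d+q<m) ⟩
    f i            ∎
    where
    d = p ∸ q
    i+d+q≡i+p = trans (+-assoc i d q) (cong (i +_) (m∸n+n≡m q≤p))
    i+d+q<m = m≤o∸n⇒m+n≤o (suc (i + d)) (≤-trans q≤p p≤m) i+d<m∸q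

  Period⇒PeriodicBelow : ∀ d X {q} → Period X q → PeriodicBelow (length X) (nth d X) q
  Period⇒PeriodicBelow d X {q} (_ , _ , per) i i+q<X = just-injective (begin
    just (nth d X (i + q))  ≡⟨ at≡just-nth d X (i + q) i+q<X ⟨
    at X (i + q)            ≡⟨ per i i+q<X ⟩
    at X i                  ≡⟨ at≡just-nth d X i (≤-<-trans (m≤m+n i q) i+q<X) ⟩
    just (nth d X i)        ∎)

  PeriodicBelow⇒Period : ∀ d X {q} → 1 ≤ q → q ≤ length X → PeriodicBelow (length X) (nth d X) q →
                         Period X q
  PeriodicBelow⇒Period d X {q} 1≤q q≤X per = 1≤q , q≤X , λ i i+q<X → begin
    at X (i + q)            ≡⟨ at≡just-nth d X (i + q) i+q<X ⟩
    just (nth d X (i + q))  ≡⟨ cong just (per i i+q<X) ⟩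
    just (nth d X i)        ≡⟨ at≡just-nth d X i (≤-<-trans (m≤m+n i q) i+q<X) ⟨
    at X i                  ∎

  ω-periodicPrefix : ∀ d {m} x xs W → IsPrefix (x ∷ xs) W → PeriodicBelow m (nth d W) (suc (length xs)) →
                     AgreeBelow m (ω x xs) (nth d W)
  ω-periodicPrefix d x xs W prefix per i i<m = begin
    ω x xs i                ≡⟨ nth-default x d (x ∷ xs) (i % q) (m%n<n i q) ⟩
    nth d (x ∷ xs) (i % q)  ≡⟨ nth-prefix d (i % q) prefix (m%n<n i q) ⟩
    nth d W (i % q)         ≡⟨ PeriodicBelow-% per i i<m ⟩
    nth d W i               ∎
    where q = suc (length xs)

  ≺alt-irrefl : ∀ X → ¬ X ≺alt X
  ≺alt-irrefl []       ()
  ≺alt-irrefl (x ∷ xs) = ≺ω-irrefl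

  ≺alt-at-firstDifference : ∀ d X Y m → m < length X → m < length Y →
    AgreeBelow m (nth d X) (nth d Y) → nth d X m ≢ nth d Y m → X ≺alt Y →
    Alt (parity m) (nth d X m) (nth d Y m)
  ≺alt-at-firstDifference d (x ∷ xs) (y ∷ ys) m m<X m<Y agree differ X≺Y =
    subst₂ (Alt (parity m)) (ωX m m<X) (ωY m m<Y)
      (≺ω-at-firstDifference m agreeω (λ e → differ (trans (sym (ωX m m<X)) (trans e (ωY m m<Y)))) X≺Y)
    where
    ωX = ω-lookup d x xs
    ωY = ω-lookup d y ys
    agreeω : AgreeBelow m (ω x xs) (ω y ys)
    agreeω i i<m = trans (ωX i (<-trans i<m m<X)) (trans (agree i i<m) (sym (ωY i (<-trans i<m m<Y))))

  ≺alt-at-lastIndex : ∀ d X Y r → length X ≡ suc r → length Y ≡ suc r →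
    AgreeBelow r (nth d X) (nth d Y) → X ≺alt Y → Alt (parity r) (nth d X r) (nth d Y r)
  ≺alt-at-lastIndex d X Y r |X| |Y| agree X≺Y with nth d X r ≟ nth d Y r
  ... | no differ = ≺alt-at-firstDifference d X Y r (lastIndex X |X|) (lastIndex Y |Y|) agree differ X≺Y
    where
    lastIndex : ∀ Z → length Z ≡ suc r → r < length Z
    lastIndex Z |Z| = subst (r <_) (sym |Z|) ≤-refl
  ... | yes same =
    ⊥-elim (≺alt-irrefl Y (subst (_≺alt Y) (nth-extensional d X Y (trans |X| (sym |Y|)) agreeAll) X≺Y))
    where
    agreeAll : AgreeBelow (length X) (nth d X) (nth d Y)
    agreeAll i i<X = [ agree i , (λ { refl → same }) ] (m<1+n⇒m<n∨m≡n (subst (i <_) |X| i<X))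

  module PeriodBreak (d : A) {x xs y ys} (a : ℕ) (prefix : IsPrefix (x ∷ xs) (y ∷ ys))
                     (m<W : a + suc (length xs) < suc (length ys))
                     (per : PeriodicBelow (a + suc (length xs)) (nth d (y ∷ ys)) (suc (length xs))) where
    q = suc (length xs)
    m = a + q

    agree : AgreeBelow m (ω x xs) (ω y ys)
    agree i i<m = trans (ω-periodicPrefix d x xs (y ∷ ys) prefix per i i<m)
                        (sym (ω-lookup d y ys i (<-trans i<m m<W)))

    ωQ-at-break : ω x xs m ≡ nth d (y ∷ ys) a
    ωQ-at-break = trans (ω-+length x xs a) (ω-periodicPrefix d x xs (y ∷ ys) prefix per a (m<m+n a z<s))

    ωW-at-break : ω y ys m ≡ nth d (y ∷ ys) m
    ωW-at-break = ω-lookup d y ys m m<W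

  -- Q^ω copies W up to the break at a + q and then repeats W[a]; comparing with the parity of a
  -- instead of a + q absorbs the case split of SCond on the parity of q.
  SCond-at-periodBreak : ∀ d Q W {q} a → IsPrefix Q W → length Q ≡ q → a + q < length W →
    PeriodicBelow (a + q) (nth d W) q → Alt (parity a) (nth d W (a + q)) (nth d W a) → SCond Q W
  SCond-at-periodBreak d []       W        a _      refl _   _   l =
    ⊥-elim (Alt⇒≢ (parity a) l (cong (nth d W) (+-identityʳ a)))
  SCond-at-periodBreak d (x ∷ xs) (y ∷ ys) a prefix refl m<W per l = even , odd
    where
    open PeriodBreak d a prefix m<W per
    even : Even q → (y ∷ ys) ⪯alt (x ∷ xs)
    even e = inj₁ (≺ω-intro m (λ i i<m → sym (agree i i<m))
      (subst₂ (Alt (parity m)) (sym ωW-at-break) (sym ωQ-at-break) (Alt-+-even a q (Even⇒parity≡0ℙ q e) l)))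
    odd : Odd q → (x ∷ xs) ⪯alt (y ∷ ys)
    odd o = inj₁ (≺ω-intro m agree
      (subst₂ (Alt (parity m)) (sym ωQ-at-break) (sym ωW-at-break) (Alt-+-odd a q (Odd⇒parity≡1ℙ q o) l)))

  ¬SCond-at-periodBreak : ∀ d Q W {q} a → IsPrefix Q W → length Q ≡ q → a + q < length W →
    PeriodicBelow (a + q) (nth d W) q → Alt (parity a) (nth d W a) (nth d W (a + q)) → ¬ SCond Q W
  ¬SCond-at-periodBreak d []       W        a _      refl _   _   l _ =
    Alt⇒≢ (parity a) l (cong (nth d W) (sym (+-identityʳ a)))
  ¬SCond-at-periodBreak d (x ∷ xs) (y ∷ ys) a prefix refl m<W per l (even , odd) = refute (parity q) refl
    where
    open PeriodBreak d a prefix m<W per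
    refute : ∀ π → parity q ≡ π → ⊥
    refute 0ℙ e = ⪯ω-refute m agree
      (subst₂ (Alt (parity m)) (sym ωQ-at-break) (sym ωW-at-break) (Alt-+-even a q e l))
      (even (parity≡0ℙ⇒Even q e))
    refute 1ℙ o = ⪯ω-refute m (λ i i<m → sym (agree i i<m))
      (subst₂ (Alt (parity m)) (sym ωW-at-break) (sym ωQ-at-break) (Alt-+-odd a q o l))
      (odd (parity≡1ℙ⇒Odd q o))

  PreGalois-periodBreak : ∀ d X k i → PreGalois X → 1 ≤ k → i + k < length X →
    PeriodicBelow (i + k) (nth d X) k → nth d X (i + k) ≢ nth d X i →
    Alt (parity i) (nth d X i) (nth d X (i + k))
  PreGalois-periodBreak d X k i preGalois 1≤k i+k<X per broken =
    [ prefixCase , followsCase ] (preGalois k 1≤k (≤-trans (m≤n+m k i) (<⇒≤ i+k<X)))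
    where
    D = drop k X
    i<D : i < length D
    i<D = subst (i <_) (sym (length-drop k X)) (m+n≤o⇒m≤o∸n (suc i) i+k<X)
    prefixCase : IsPrefix D X → Alt (parity i) (nth d X i) (nth d X (i + k))
    prefixCase prefix = ⊥-elim (broken (trans (sym (nth-drop d k X i)) (nth-prefix d i prefix i<D)))
    followsCase : D ≻alt X → Alt (parity i) (nth d X i) (nth d X (i + k))
    followsCase X≺D = subst (Alt (parity i) (nth d X i)) (nth-drop d k X i)
      (≺alt-at-firstDifference d X D i (≤-<-trans (m≤m+n i k) i+k<X) i<D
        (λ j j<i → sym (trans (nth-drop d k X j) (per j (+-monoˡ-< k j<i))))
        (λ e → broken (trans (sym (nth-drop d k X i)) (sym e)))
        X≺D)

  module Extension (T : List A) (z : A) (S : List A) where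

    T′ : List A
    T′ = T ++ z ∷ []

    W : List A
    W = T′ ++ S

    n : ℕ
    n = length T

    -- w i is W[i+1] in the 1-indexed notation of the statement.
    w : ℕ → A
    w = nth z W

    Per : ℕ → Set
    Per = PeriodicBelow n w

    length-T′ : length T′ ≡ suc n
    length-T′ = trans (length-++ T) (+-comm n 1)

    ≤n⇒<length-W : ∀ {i} → i ≤ n → i < length W
    ≤n⇒<length-W i≤n = subst (_ <_) (sym (length-++ T′))
      (<-≤-trans (subst (_ <_) (sym length-T′) (s≤s i≤n)) (m≤m+n (length T′) (length S)))

    w-T′ : ∀ i → i ≤ n → nth z T′ i ≡ w i
    w-T′ i i≤n = nth-prefix z {T′} i (S , refl) (subst (i <_) (sym length-T′) (s≤s i≤n))

    w-T : ∀ i → i < n → nth z T i ≡ w i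
    w-T i = nth-prefix z {T} i (z ∷ S , sym (++-assoc T (z ∷ []) S))

    w-n : w n ≡ z
    w-n = trans (sym (w-T′ n ≤-refl)) (nth-++-length z T z [])

    length-take-T′ : ∀ {p} → p ≤ suc n → length (take p T′) ≡ p
    length-take-T′ {p} p≤1+n =
      trans (length-take p T′) (m≤n⇒m⊓n≡m (subst (p ≤_) (sym length-T′) p≤1+n))

    Period⇒Per : ∀ {q} → Period T q → Per q
    Period⇒Per period = PeriodicBelow-cong w-T (Period⇒PeriodicBelow z T period)

    Per⇒Period : ∀ {q} → 1 ≤ q → q ≤ n → Per q → Period T q
    Per⇒Period 1≤q q≤n per =
      PeriodicBelow⇒Period z T 1≤q q≤n (PeriodicBelow-cong (λ i i<n → sym (w-T i i<n)) per)

    preGalois-periodBreak : ∀ {k i} → PreGalois T → 1 ≤ k → i + k < n →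
      PeriodicBelow (i + k) w k → w (i + k) ≢ w i → Alt (parity i) (w i) (w (i + k))
    preGalois-periodBreak {k} {i} preGalois 1≤k i+k<n per broken =
      subst₂ (Alt (parity i)) (w-T i i<n) (w-T (i + k) i+k<n)
        (PreGalois-periodBreak z T k i preGalois 1≤k i+k<n
          (PeriodicBelow-cong (λ j j<i+k → sym (w-T j (<-trans j<i+k i+k<n))) per)
          (λ e → broken (trans (sym (w-T (i + k) i+k<n)) (trans e (w-T i i<n)))))
      where i<n = ≤-<-trans (m≤m+n i k) i+k<n

    Cond : ℕ → Set
    Cond p = fac T′ 1 (suc n ∸ p) ≻alt fac T′ (p + 1) (n + 1)

    ZPrecedes : ℕ → Set
    ZPrecedes p = Alt (parity (n ∸ p)) z (w (n ∸ p))

    ZFollows : ℕ → Set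
    ZFollows p = Alt (parity (n ∸ p)) (w (n ∸ p)) z

    IsShortestPeriod : Parity → ℕ → Set
    IsShortestPeriod π p = Period T p × parity p ≡ π × (∀ q → Period T q → parity q ≡ π → p ≤ q)

    suffix≡drop : ∀ p → fac T′ (p + 1) (n + 1) ≡ drop p T′
    suffix≡drop p = fac-suffix T′ p (n + 1) (≤-reflexive (length-++ T))

    Cond⇒≤ : ∀ {p} → Cond p → p ≤ n
    Cond⇒≤ {p} c with p ≤? n
    ... | yes p≤n = p≤n
    ... | no  p≰n = ⊥-elim (subst (_≺alt take (suc n ∸ p) T′) suffix≡[] c)
      where
      suffix≡[] : fac T′ (p + 1) (n + 1) ≡ []
      suffix≡[] = trans (suffix≡drop p) (drop-all p T′ (subst (_≤ p) (sym length-T′) (≰⇒> p≰n)))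

    Cond⇒ZPrecedes : ∀ {p} → Period T p → Cond p → ZPrecedes p
    Cond⇒ZPrecedes {p} period@(_ , p≤n , _) c =
      subst₂ (Alt (parity r)) Y[r]≡z (X[i]≡w r ≤-refl)
        (≺alt-at-lastIndex z Y X r |Y| |X| agree (subst (_≺alt X) (suffix≡drop p) c))
      where
      r = n ∸ p
      X = take (suc n ∸ p) T′
      Y = drop p T′
      1+r : suc n ∸ p ≡ suc r
      1+r = +-∸-assoc 1 p≤n
      r+p≡n : r + p ≡ n
      r+p≡n = m∸n+n≡m p≤n
      |X| : length X ≡ suc r
      |X| = trans (length-take-T′ (m∸n≤m (suc n) p)) 1+r
      |Y| : length Y ≡ suc r
      |Y| = trans (length-drop p T′) (trans (cong (_∸ p) length-T′) 1+r)
      X[i]≡w : ∀ i → i ≤ r → nth z X i ≡ w i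
      X[i]≡w i i≤r = trans (nth-take z (suc n ∸ p) T′ i (subst (i <_) (sym 1+r) (s≤s i≤r)))
                           (w-T′ i (≤-trans i≤r (m∸n≤m n p)))
      Y[i]≡w : ∀ i → i ≤ r → nth z Y i ≡ w (i + p)
      Y[i]≡w i i≤r =
        trans (nth-drop z p T′ i) (w-T′ (i + p) (subst (i + p ≤_) r+p≡n (+-monoˡ-≤ p i≤r)))
      agree : AgreeBelow r (nth z Y) (nth z X)
      agree i i<r = begin
        nth z Y i  ≡⟨ Y[i]≡w i (<⇒≤ i<r) ⟩
        w (i + p)  ≡⟨ Period⇒Per period i (subst (i + p <_) r+p≡n (+-monoˡ-< p i<r)) ⟩
        w i        ≡⟨ X[i]≡w i (<⇒≤ i<r) ⟨
        nth z X i  ∎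
      Y[r]≡z : nth z Y r ≡ z
      Y[r]≡z = trans (Y[i]≡w r ≤-refl) (trans (cong w r+p≡n) w-n)

    ZPrecedes⇒ZFollows : ∀ {p q} → PreGalois T → Period T q → Period T p → q < p →
                         parity q ≢ parity p → ZPrecedes p → ZFollows q
    ZPrecedes⇒ZFollows {p} {q} preGalois periodq@(1≤q , q≤n , _) periodp@(_ , p≤n , _) q<p q≢p zp =
      subst (λ m → Alt (parity m) (w m) z) (sym n∸q≡r+d)
        (Alt-+-odd r d (parity≢⇒odd-∸ (<⇒≤ q<p) q≢p) z≺w[r+d])
      where
      d = p ∸ q
      r = n ∸ p
      n∸q≡r+d : n ∸ q ≡ r + d
      n∸q≡r+d = trans (cong (_∸ q) (sym (m∸n+n≡m p≤n))) (+-∸-assoc r (<⇒≤ q<p))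
      periodic-d : PeriodicBelow (r + d) w d
      periodic-d = subst (λ m → PeriodicBelow m w d) n∸q≡r+d
        (PeriodicBelow-∸ (Period⇒Per periodq) (Period⇒Per periodp) (<⇒≤ q<p) p≤n)
      z≺w[r+d] : Alt (parity r) z (w (r + d))
      z≺w[r+d] with w (r + d) ≟ w r
      ... | yes same  = subst (Alt (parity r) z) (sym same) zp
      ... | no broken = Alt-trans (parity r) zp
        (preGalois-periodBreak preGalois (m<n⇒0<n∸m q<p) (subst (_< n) n∸q≡r+d (∸-monoʳ-< 1≤q q≤n))
          periodic-d broken)

    ZPrecedes-excludesShorter : ∀ {p q} → PreGalois T → Period T q → Period T p → q < p →
                                parity q ≢ parity p → ZPrecedes p → ¬ ZPrecedes q
    ZPrecedes-excludesShorter {q = q} preGalois periodq periodp q<p q≢p zp zq =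
      Alt-asym (parity (n ∸ q)) zq (ZPrecedes⇒ZFollows preGalois periodq periodp q<p q≢p zp)

    Cond-exclusive : ∀ {π ρ p q} → PreGalois T → IsShortestPeriod π p → IsShortestPeriod ρ q →
                     π ≢ ρ → Cond p → ¬ Cond q
    Cond-exclusive {p = p} {q} preGalois (periodp , πp , _) (periodq , ρq , _) π≢ρ cp cq with <-cmp p q
    ... | tri< p<q _ _  = ZPrecedes-excludesShorter preGalois periodp periodq p<q p≢q
                            (Cond⇒ZPrecedes periodq cq) (Cond⇒ZPrecedes periodp cp)
      where p≢q = λ e → π≢ρ (trans (sym πp) (trans e ρq))
    ... | tri≈ _ refl _ = π≢ρ (trans (sym πp) ρq)
    ... | tri> _ _ q<p  = ZPrecedes-excludesShorter preGalois periodq periodp q<p q≢p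
                            (Cond⇒ZPrecedes periodp cp) (Cond⇒ZPrecedes periodq cq)
      where q≢p = λ e → π≢ρ (trans (sym πp) (trans (sym e) ρq))

    take-SCond : ∀ {p} → Period T p → ZPrecedes p → SCond (take p T′) W
    take-SCond {p} period@(_ , p≤n , _) zp =
      SCond-at-periodBreak z (take p T′) W r (IsPrefix-++ S (take-isPrefix p T′))
        (length-take-T′ (m≤n⇒m≤1+n p≤n)) (≤n⇒<length-W (≤-reflexive r+p≡n))
        (subst (λ m → PeriodicBelow m w p) (sym r+p≡n) (Period⇒Per period))
        (subst (λ a → Alt (parity r) a (w r)) (sym (trans (cong w r+p≡n) w-n)) zp)
      where
      r = n ∸ p
      r+p≡n = m∸n+n≡m p≤n

    periodicPrefix-¬SCond : ∀ {π p} Q → PreGalois T → IsShortestPeriod π p → ZPrecedes p → IsPrefix Q W →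
                            1 ≤ length Q → length Q < p → Per (length Q) → ¬ SCond Q W
    periodicPrefix-¬SCond {p = p} Q preGalois (periodp@(_ , p≤n , _) , πp , shortest) zp prefix 1≤q q<p per =
      ¬SCond-at-periodBreak z Q W (n ∸ q) prefix refl (≤n⇒<length-W (≤-reflexive n∸q+q≡n))
        (subst (λ m → PeriodicBelow m w q) (sym n∸q+q≡n) per)
        (subst (Alt (parity (n ∸ q)) (w (n ∸ q))) (sym (trans (cong w n∸q+q≡n) w-n))
          (ZPrecedes⇒ZFollows preGalois periodq periodp q<p q≢p zp))
      where
      q = length Q
      q≤n = <⇒≤ (<-≤-trans q<p p≤n)
      n∸q+q≡n = m∸n+n≡m q≤n
      periodq = Per⇒Period 1≤q q≤n per
      q≢p : parity q ≢ parity p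
      q≢p e = <⇒≱ q<p (shortest q periodq (trans e πp))

    shorterPrefix-¬SCond : ∀ {π p} → PreGalois T → IsShortestPeriod π p → ZPrecedes p →
      ∀ Q → IsPrefix Q W → Q ≢ [] → length Q < p → ¬ SCond Q W
    shorterPrefix-¬SCond _ _ _ [] _ Q≢[] _ = ⊥-elim (Q≢[] refl)
    shorterPrefix-¬SCond preGalois shortest@((_ , p≤n , _) , _) zp Q@(_ ∷ _) prefix _ q<p
      with allBelow-or-leastCounterexample (λ i → w (i + length Q) ≟ w i) (n ∸ length Q)
    ... | inj₁ periodic =
      periodicPrefix-¬SCond Q preGalois shortest zp prefix (s≤s z≤n) q<p
        (λ i i+q<n → periodic i (m+n≤o⇒m≤o∸n (suc i) i+q<n))
    ... | inj₂ (i , i<n∸q , below , broken) =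
      ¬SCond-at-periodBreak z Q W i prefix refl (≤n⇒<length-W (<⇒≤ i+q<n)) per
        (preGalois-periodBreak preGalois (s≤s z≤n) i+q<n per broken)
      where
      i+q<n = m≤o∸n⇒m+n≤o (suc i) (<⇒≤ (<-≤-trans q<p p≤n)) i<n∸q
      per : PeriodicBelow (i + length Q) w (length Q)
      per j j+q<i+q = below j (+-cancelʳ-< (length Q) j i j+q<i+q)

    IsShortestPeriod⇒IsSPref : ∀ {π p} → PreGalois T → IsShortestPeriod π p → Cond p →
                               IsSPref W (take p T′)
    IsShortestPeriod⇒IsSPref {p = p} preGalois shortest@(period@(1≤p , p≤n , _) , _) c =
        IsPrefix-++ S (take-isPrefix p T′)
      , (λ P≡[] → <⇒≢ 1≤p (trans (sym (cong length P≡[])) |P|))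
      , take-SCond period zp
      , λ Q prefix Q≢[] |Q|<|P| →
          shorterPrefix-¬SCond preGalois shortest zp Q prefix Q≢[] (subst (length Q <_) |P| |Q|<|P|)
      where
      zp = Cond⇒ZPrecedes period c
      |P| = length-take-T′ (m≤n⇒m≤1+n p≤n)

    IsPerO⇒IsShortestPeriod : ∀ {p} → IsPerO T p → Cond p → IsShortestPeriod 1ℙ p
    IsPerO⇒IsShortestPeriod {p} (inj₁ (period , odd , least)) _ =
      period , Odd⇒parity≡1ℙ p odd , λ q periodq e → least q periodq (parity≡1ℙ⇒Odd q e)
    IsPerO⇒IsShortestPeriod (inj₂ (_ , refl)) c = ⊥-elim (<-irrefl refl (Cond⇒≤ c))

    IsPerE⇒IsShortestPeriod : ∀ {p} → IsPerE T p → Cond p → IsShortestPeriod 0ℙ p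
    IsPerE⇒IsShortestPeriod {p} (inj₁ (period , even , least)) _ =
      period , Even⇒parity≡0ℙ p even , λ q periodq e → least q periodq (parity≡0ℙ⇒Even q e)
    IsPerE⇒IsShortestPeriod (inj₂ (_ , refl)) c = ⊥-elim (<-irrefl refl (Cond⇒≤ c))

lemma28 : {A : Set} (_<ₐ_ : A → A → Set) → IsStrictTotalOrder _≡_ _<ₐ_ →
    let open Alphabet A _<ₐ_ in
    (T : List A) (po pe : ℕ) (z : A) →
    PreGalois T → IsPerO T po → IsPerE T pe →
    let T′ = T ++ (z ∷ []) in
    let n = length T in
    let CondA = fac T′ 1 (suc n ∸ po) ≻alt fac T′ (po + 1) (n + 1) in
    let CondB = fac T′ 1 (suc n ∸ pe) ≻alt fac T′ (pe + 1) (n + 1) in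
    CondA ⊎ CondB →
    (S : List A) →
      ((CondA × CondB) → IsSPref (T′ ++ S) (fac T′ 1 (po ⊓ pe)))
    × ((CondA × (fac T′ 1 (suc n ∸ pe) ⪯alt fac T′ (pe + 1) (n + 1)))
         → IsSPref (T′ ++ S) (fac T′ 1 po))
    × ((CondB × ¬ CondA) → IsSPref (T′ ++ S) (fac T′ 1 pe))
lemma28 _<ₐ_ <ₐ-sto T po pe z preGalois isPerO isPerE _ S =
    (λ (condA , condB) →
       ⊥-elim (Cond-exclusive preGalois (shortestOdd condA) (shortestEven condB) (λ ()) condA condB))
  , (λ (condA , _) → IsShortestPeriod⇒IsSPref preGalois (shortestOdd condA) condA)
  , (λ (condB , _) → IsShortestPeriod⇒IsSPref preGalois (shortestEven condB) condB)
  where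
  open AlternatingOrder _<ₐ_ <ₐ-sto
  open Extension T z S
  shortestOdd = IsPerO⇒IsShortestPeriod isPerO
  shortestEven = IsPerE⇒IsShortestPeriod isPerE
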